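{- Let $T$ be a tree with $n\ge1$ vertices and $\ell\ge1$ an integer. Then every $x\in P_\ell(T)\cap\mathbb{Z}^n$ is a self-reachable configuration on $T$.
   Context: Label the vertices $v_1,\dots,v_n$. A chip configuration on $T$ is a vector $c\in\mathbb{Z}_{\ge 0}^n$ ($c_i$ chips on $v_i$). The Laplacian $\Delta(T)$ has $\Delta_{ii}=\deg(v_i)$, $\Delta_{ij}=-1$ if $v_iv_j$ is an edge, $0$ otherwise. Firing $v_i$ from $c$ produces $c-\Delta(T)e_i$, legal if $c_i\ge\deg(v_i)$. A configuration $c$ is self-reachable on $T$ if some nonempty finite sequence of legal firings starting from $c$ ends at $c$. (Known: equivalently, $c$ has at least $m-1$ chips on every $m$-vertex subtree of $T$.) $S_\ell^{(T)}$ is the set of self-reachable configurations with exactly $\ell$ chips and $P_\ell(T)=\mathrm{conv}(S_\ell^{(T)})$.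
   Formalization: The convex combinations defining $P_\ell(T)$ have rational coefficients, so x must be a rational convex combination of configurations in $S_\ell^{(T)}$. -}

module Defs where

open import Data.Nat as ℕ using (ℕ; zero; suc; _≤_; _∸_)
open import Data.Fin using (Fin; zero; suc)
open import Data.Bool using (Bool; true; false; if_then_else_)
open import Data.List using (List; []; _∷_)
open import Data.List.Relation.Unary.All using (All)
open import Data.Product using (Σ; _×_; _,_; ∃)
open import Data.Integer as ℤ using (ℤ; +_)
open import Data.Rational as ℚ using (ℚ; _/_; 0ℚ; 1ℚ)
open import Relation.Binary.PropositionalEquality using (_≡_; _≢_)
open import Relation.Nullary using (¬_; does)
open import Data.Fin using (_≟_)
open import Data.Unit using (⊤)

sumFin : (n : ℕ) → (Fin n → ℕ) → ℕ
sumFin zero    f = 0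
sumFin (suc n) f = f zero ℕ.+ sumFin n (λ i → f (suc i))

record Graph (n : ℕ) : Set where
  field
    adj   : Fin n → Fin n → Bool
    sym   : ∀ i j → adj i j ≡ adj j i
    irrefl : ∀ i → adj i i ≡ false

open Graph public

indicator : Bool → ℕ
indicator true  = 1
indicator false = 0

deg : ∀ {n} → Graph n → Fin n → ℕ
deg {n} G v = sumFin n (λ w → indicator (adj G v w))

data Walk {n : ℕ} (G : Graph n) : Fin n → Fin n → Set where
  here : ∀ {u} → Walk G u u
  step : ∀ {u w v} → adj G u w ≡ true → Walk G w v → Walk G u v

Connected : ∀ {n} → Graph n → Set
Connected {n} G = (u v : Fin n) → Walk G u v

-- A tree on n ≥ 1 vertices: a connected simple graph with exactly n - 1 edges
-- (number of edges expressed via the handshake identity Σ deg = 2|E|).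
IsTree : ∀ {n} → Graph n → Set
IsTree {n} G = Connected G × (sumFin n (deg G) ≡ 2 ℕ.* (n ∸ 1))

Config : ℕ → Set
Config n = Fin n → ℕ

totalChips : ∀ {n} → Config n → ℕ
totalChips {n} c = sumFin n c

-- Firing v: c - Δ e_v.  Legal iff deg v ≤ c v (so ∸ is exact subtraction).
fire : ∀ {n} → Graph n → Config n → Fin n → Config n
fire G c v w =
  if does (w ≟ v) then c w ∸ deg G v
  else (if adj G v w then suc (c w) else c w)

fireSeq : ∀ {n} → Graph n → Config n → List (Fin n) → Config n
fireSeq G c []       = c
fireSeq G c (v ∷ vs) = fireSeq G (fire G c v) vs

LegalSeq : ∀ {n} → Graph n → Config n → List (Fin n) → Set
LegalSeq G c []       = ⊤
LegalSeq G c (v ∷ vs) = (deg G v ≤ c v) × LegalSeq G (fire G c v) vs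

SelfReachable : ∀ {n} → Graph n → Config n → Set
SelfReachable {n} G c =
  Σ (List (Fin n)) λ vs → (vs ≢ []) × LegalSeq G c vs × ((i : Fin n) → fireSeq G c vs i ≡ c i)

InS : ∀ {n} → Graph n → ℕ → Config n → Set
InS G ℓ c = SelfReachable G c × (totalChips c ≡ ℓ)

ℕtoℚ : ℕ → ℚ
ℕtoℚ k = (+ k) / 1

ℤtoℚ : ℤ → ℚ
ℤtoℚ z = z / 1

sumWeights : ∀ {n} → List (ℚ × Config n) → ℚ
sumWeights []              = 0ℚ
sumWeights ((λ' , _) ∷ ps) = λ' ℚ.+ sumWeights ps

combAt : ∀ {n} → List (ℚ × Config n) → Fin n → ℚ
combAt []              i = 0ℚ
combAt ((λ' , s) ∷ ps) i = λ' ℚ.* ℕtoℚ (s i) ℚ.+ combAt ps i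

-- x ∈ conv(S_ℓ(T)) : x is a convex combination of finitely many points of S_ℓ(T)
-- (rational coefficients).
InP : ∀ {n} → Graph n → ℕ → (Fin n → ℚ) → Set
InP {n} G ℓ x =
  Σ (List (ℚ × Config n)) λ ps →
    All (λ p → (0ℚ ℚ.≤ Data.Product.proj₁ p) × InS G ℓ (Data.Product.proj₂ p)) ps
    × (sumWeights ps ≡ 1ℚ)
    × ((i : Fin n) → x i ≡ combAt ps i)

{-# OPTIONS --safe #-}
module Submission where

-- Call c edge-covering if every vertex set U carries at least as many chips as
-- the subgraph induced by U has edges.  On a connected graph a self-reachable
-- configuration is edge-covering: a returning firing sequence fires every vertex,
-- and after the last firing of u ∈ U, u gains a chip from each later-fired
-- neighbour in U.  Edge-covering is a family of linear inequalities, so it passes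
-- to the integral points of the convex hull.  Conversely, on a tree an
-- edge-covering c is self-reachable: an induced forest on U has at most |U| - 1
-- edges, so some unfired vertex has at most c v unfired neighbours and may fire
-- legally; firing every vertex once in such an order returns to c.

open import Defs renaming (sym to adj-sym)
open import Algebra.Bundles using (CommutativeRing)
open import Data.Bool using (Bool; true; false; not; if_then_else_)
open import Data.Bool.Properties using (not-injective)
open import Data.Fin using (Fin; zero; suc; _≟_)
import Data.Fin.Properties as Fin
open import Data.Integer as ℤ using (ℤ)
import Data.Integer.Properties as ℤ
open import Data.List using (List; []; _∷_; length; map)
open import Data.Nat.ListAction using (sum)
open import Data.List.Membership.Propositional using (_∈_; _∉_)
import Data.List.Membership.DecPropositional as DecMembership
open import Data.List.Relation.Unary.All as All using (All; []; _∷_)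
open import Data.List.Relation.Unary.Any using (here; there)
open import Data.Nat using (ℕ; zero; suc; _+_; _*_; _∸_; _≤_; _<_; z≤n; z<s; >-nonZero⁻¹)
open import Data.Nat.Properties hiding (_≟_)
open import Data.Nat.Tactic.RingSolver using (solve-∀)
import Data.Nat.Coprimality as Coprimality
open import Data.Product using (Σ; ∃-syntax; ∃₂; _×_; _,_; proj₁; proj₂)
open import Data.Rational as ℚ using (ℚ; mkℚ; 0ℚ; 1ℚ; *≤*)
import Data.Rational.Properties as ℚ
open import Data.Rational.Solver using (module +-*-Solver)
open import Data.Unit using (tt)
open import Function using (_∘_)
open import Relation.Nullary using (yes; no; does; contradiction)
open import Relation.Nullary.Decidable using (dec-true; dec-false)
open import Relation.Binary.PropositionalEquality

open import Algebra.Properties.CommutativeSemigroup +-commutativeSemigroup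
  using (interchange; xy∙z≈xz∙y)
open import Algebra.Properties.Semiring.Sum (CommutativeRing.semiring ℚ.+-*-commutativeRing)
  using (∑-distrib-+; *-distribˡ-sum; sum-cong-≗; sum-replicate-zero)
  renaming (sum to ∑)

sumFin-cong : ∀ n {f g : Fin n → ℕ} → (∀ i → f i ≡ g i) → sumFin n f ≡ sumFin n g
sumFin-cong zero    f≗g = refl
sumFin-cong (suc n) f≗g = cong₂ _+_ (f≗g zero) (sumFin-cong n (f≗g ∘ suc))

sumFin-+ : ∀ n (f g : Fin n → ℕ) → sumFin n (λ i → f i + g i) ≡ sumFin n f + sumFin n g
sumFin-+ zero    f g = refl
sumFin-+ (suc n) f g =
  trans (cong (_+_ (f zero + g zero)) (sumFin-+ n (f ∘ suc) (g ∘ suc))) (interchange (f zero) (g zero) _ _)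

sumFin-*ˡ : ∀ n k (f : Fin n → ℕ) → sumFin n (λ i → k * f i) ≡ k * sumFin n f
sumFin-*ˡ zero    k f = sym (*-zeroʳ k)
sumFin-*ˡ (suc n) k f =
  trans (cong (_+_ (k * f zero)) (sumFin-*ˡ n k (f ∘ suc))) (sym (*-distribˡ-+ k (f zero) _))

sumFin-zero : ∀ n {f : Fin n → ℕ} → (∀ i → f i ≡ 0) → sumFin n f ≡ 0
sumFin-zero zero    f≗0 = refl
sumFin-zero (suc n) f≗0 = cong₂ _+_ (f≗0 zero) (sumFin-zero n (f≗0 ∘ suc))

sumFin-1 : ∀ n → sumFin n (λ _ → 1) ≡ n
sumFin-1 zero    = refl
sumFin-1 (suc n) = cong suc (sumFin-1 n)

f≤sumFin : ∀ n (i : Fin n) (f : Fin n → ℕ) → f i ≤ sumFin n f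
f≤sumFin (suc n) zero    f = m≤m+n _ _
f≤sumFin (suc n) (suc i) f = ≤-trans (f≤sumFin n i (f ∘ suc)) (m≤n+m _ _)

sumFin≡0⇒≡0 : ∀ n {f : Fin n → ℕ} → sumFin n f ≡ 0 → ∀ i → f i ≡ 0
sumFin≡0⇒≡0 n {f} Σf≡0 i = n≤0⇒n≡0 (subst (f i ≤_) Σf≡0 (f≤sumFin n i f))

sumFin-<⇒∃< : ∀ n (f g : Fin n → ℕ) → sumFin n f < sumFin n g → ∃[ i ] f i < g i
sumFin-<⇒∃< (suc n) f g Σf<Σg with f zero <? g zero
... | yes f₀<g₀ = zero , f₀<g₀
... | no  f₀≮g₀ =
  let i , fi<gi = sumFin-<⇒∃< n (f ∘ suc) (g ∘ suc)
                    (+-cancelˡ-< (g zero) _ _ (≤-<-trans (+-monoˡ-≤ _ (≮⇒≥ f₀≮g₀)) Σf<Σg))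
  in suc i , fi<gi

sumFin-update : ∀ n (v : Fin n) {f g : Fin n → ℕ} k →
  (∀ i → i ≢ v → g i ≡ f i) → g v ≡ f v + k → sumFin n g ≡ sumFin n f + k
sumFin-update (suc n) zero {f} k g≗f gv =
  trans (cong₂ _+_ gv (sumFin-cong n (λ i → g≗f (suc i) λ ()))) (xy∙z≈xz∙y (f zero) k _)
sumFin-update (suc n) (suc v) {f} k g≗f gv =
  trans (cong₂ _+_ (g≗f zero λ ()) (sumFin-update n v k (λ i i≢v → g≗f (suc i) (i≢v ∘ Fin.suc-injective)) gv))
        (sym (+-assoc (f zero) _ k))

mask : Bool → ℕ → ℕ
mask b x = if b then x else 0

mask-+ : ∀ b x y → mask b (x + y) ≡ mask b x + mask b y
mask-+ true  x y = refl
mask-+ false x y = refl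

mask-+-not : ∀ b x → mask b x + mask (not b) x ≡ x
mask-+-not true  x = +-identityʳ x
mask-+-not false x = refl

mask-*-comm : ∀ b k y → mask b k * y ≡ k * mask b y
mask-*-comm true  k y = refl
mask-*-comm false k y = sym (*-zeroʳ k)

mask-1≡0 : ∀ b → mask b 1 ≡ 0 → b ≡ false
mask-1≡0 true  ()
mask-1≡0 false _ = refl

mask-1>0 : ∀ b → 0 < mask b 1 → b ≡ true
mask-1>0 true  _ = refl
mask-1>0 false ()

∀-split-at : ∀ {n} {P : Fin n → Set} v → P v → (∀ w → w ≢ v → P w) → ∀ w → P w
∀-split-at v Pv P-off w with w ≟ v
... | yes refl = Pv
... | no  w≢v  = P-off w w≢v

VertexSet : ℕ → Set
VertexSet n = Fin n → Bool

module _ {n : ℕ} where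

  sumOver : VertexSet n → (Fin n → ℕ) → ℕ
  sumOver U f = sumFin n (λ i → mask (U i) (f i))

  card : VertexSet n → ℕ
  card U = sumOver U (λ _ → 1)

  ∁ : VertexSet n → VertexSet n
  ∁ U i = not (U i)

  update : VertexSet n → Fin n → Bool → VertexSet n
  update U v b u = if does (u ≟ v) then b else U u

  Extends : VertexSet n → Fin n → VertexSet n → Set
  Extends U v U' = U v ≡ false × U' v ≡ true × (∀ u → u ≢ v → U' u ≡ U u)

  update-here : ∀ U v b → update U v b v ≡ b
  update-here U v b = cong (if_then b else U v) (dec-true (v ≟ v) refl)

  update-other : ∀ U v b {u} → u ≢ v → update U v b u ≡ U u
  update-other U v b {u} u≢v = cong (if_then b else U u) (dec-false (u ≟ v) u≢v)

  extends-insert : ∀ U v → U v ≡ false → Extends U v (update U v true)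
  extends-insert U v v∉U = v∉U , update-here U v true , λ u → update-other U v true

  extends-remove : ∀ U v → U v ≡ true → Extends (update U v false) v U
  extends-remove U v v∈U =
    update-here U v false , v∈U , λ u u≢v → sym (update-other U v false u≢v)

  extends-∁ : ∀ {U v U'} → Extends U v U' → Extends (∁ U') v (∁ U)
  extends-∁ (v∉U , v∈U' , U'≗U) = cong not v∈U' , cong not v∉U , λ u u≢v → cong not (sym (U'≗U u u≢v))

  sumOver-cong : ∀ U {f g : Fin n → ℕ} → (∀ i → f i ≡ g i) → sumOver U f ≡ sumOver U g
  sumOver-cong U f≗g = sumFin-cong n (λ i → cong (mask (U i)) (f≗g i))

  sumOver-+ : ∀ U (f g : Fin n → ℕ) → sumOver U (λ i → f i + g i) ≡ sumOver U f + sumOver U g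
  sumOver-+ U f g = trans (sumFin-cong n (λ i → mask-+ (U i) (f i) (g i))) (sumFin-+ n _ _)

  sumOver-∁ : ∀ U (f : Fin n → ℕ) → sumOver U f + sumOver (∁ U) f ≡ sumFin n f
  sumOver-∁ U f = trans (sym (sumFin-+ n _ _)) (sumFin-cong n (λ i → mask-+-not (U i) (f i)))

  sumOver-full : ∀ U → (∀ u → U u ≡ true) → ∀ f → sumOver U f ≡ sumFin n f
  sumOver-full U U-full f = sumFin-cong n (λ u → cong (λ b → mask b (f u)) (U-full u))

  sumOver-empty : ∀ U → (∀ u → U u ≡ false) → ∀ f → sumOver U f ≡ 0
  sumOver-empty U U-empty f = sumFin-zero n (λ u → cong (λ b → mask b (f u)) (U-empty u))

  sumOver-extends : ∀ {U v U'} → Extends U v U' → ∀ f → sumOver U' f ≡ sumOver U f + f v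
  sumOver-extends {U} {v} {U'} (v∉U , v∈U' , U'≗U) f =
    sumFin-update n v (f v) (λ i i≢v → cong (λ b → mask b (f i)) (U'≗U i i≢v)) mask-at-v
    where
    mask-at-v : mask (U' v) (f v) ≡ mask (U v) (f v) + f v
    mask-at-v rewrite v∉U | v∈U' = refl

  card-extends : ∀ {U v U'} → Extends U v U' → card U' ≡ suc (card U)
  card-extends U⊕v = trans (sumOver-extends U⊕v _) (+-comm _ 1)

  sumOver-<⇒∃< : ∀ U (f g : Fin n → ℕ) → sumOver U f < sumOver U g → ∃[ v ] U v ≡ true × f v < g v
  sumOver-<⇒∃< U f g Σf<Σg with sumFin-<⇒∃< n _ _ Σf<Σg
  ... | v , fv<gv with U v in v∈U
  ...   | true  = v , v∈U , fv<gv
  ...   | false = contradiction fv<gv (n≮n 0)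

  _⊆ₗ_ : VertexSet n → List (Fin n) → Set
  U ⊆ₗ vs = ∀ u → U u ≡ true → u ∈ vs

  ⊆[]⇒empty : ∀ U → U ⊆ₗ [] → ∀ u → U u ≡ false
  ⊆[]⇒empty U U⊆[] u with U u in u∈U
  ... | true  = contradiction (U⊆[] u u∈U) λ ()
  ... | false = refl

  ⊆-tail : ∀ {U v vs} → U ⊆ₗ (v ∷ vs) → (U v ≡ true → v ∈ vs) → U ⊆ₗ vs
  ⊆-tail U⊆ v-later u u∈U with U⊆ u u∈U
  ... | here refl  = v-later u∈U
  ... | there u∈vs = u∈vs

  remove-⊆ : ∀ {U v vs} → U ⊆ₗ (v ∷ vs) → update U v false ⊆ₗ vs
  remove-⊆ {U} {v} {vs} U⊆ = ∀-split-at v at-v off-v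
    where
    at-v : update U v false v ≡ true → v ∈ vs
    at-v v∈U−v = contradiction (trans (sym (update-here U v false)) v∈U−v) λ ()
    off-v : ∀ u → u ≢ v → update U v false u ≡ true → u ∈ vs
    off-v u u≢v u∈U−v with U⊆ u (trans (sym (update-other U v false u≢v)) u∈U−v)
    ... | here u≡v   = contradiction u≡v u≢v
    ... | there u∈vs = u∈vs

  sumOver-remove-≤ : ∀ U v f → sumOver U f ≤ sumOver (update U v false) f + f v
  sumOver-remove-≤ U v f with U v in Uv
  ... | true  = ≤-reflexive (sumOver-extends (extends-remove U v Uv) f)
  ... | false = ≤-trans (≤-reflexive (sumFin-cong n λ u → cong (λ b → mask b (f u)) (U≗U−v u))) (m≤m+n _ _)
    where
    U≗U−v : ∀ u → U u ≡ update U v false u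
    U≗U−v = ∀-split-at v (trans Uv (sym (update-here U v false))) λ u u≢v → sym (update-other U v false u≢v)

  sumOver-⊆ : ∀ U vs f → U ⊆ₗ vs → sumOver U f ≤ sum (map f vs)
  sumOver-⊆ U []       f U⊆[] = ≤-reflexive (sumOver-empty U (⊆[]⇒empty U U⊆[]) f)
  sumOver-⊆ U (v ∷ vs) f U⊆   = begin
    sumOver U f                          ≤⟨ sumOver-remove-≤ U v f ⟩
    sumOver (update U v false) f + f v   ≤⟨ +-monoˡ-≤ (f v) (sumOver-⊆ (update U v false) vs f (remove-⊆ U⊆)) ⟩
    sum (map f vs) + f v                 ≡⟨ +-comm _ (f v) ⟩
    f v + sum (map f vs)                 ∎
    where open ≤-Reasoning

  card-full : ∀ U → (∀ u → U u ≡ true) → card U ≡ n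
  card-full U U-full = trans (sumOver-full U U-full _) (sumFin-1 n)

  card-∁≡0⇒full : ∀ U → card (∁ U) ≡ 0 → ∀ u → U u ≡ true
  card-∁≡0⇒full U ∁U≡0 u = not-injective (mask-1≡0 (not (U u)) (sumFin≡0⇒≡0 n ∁U≡0 u))

  card-∁>0⇒∃-outside : ∀ U → 0 < card (∁ U) → ∃[ u ] U u ≡ false
  card-∁>0⇒∃-outside U ∁U>0 =
    let u , 0<mask = sumFin-<⇒∃< n (λ _ → 0) _ (subst (_< card (∁ U)) (sym (sumFin-zero n λ _ → refl)) ∁U>0)
    in u , not-injective (mask-1>0 (not (U u)) 0<mask)

fire-self : ∀ {n} (G : Graph n) d v → fire G d v v ≡ d v ∸ deg G v
fire-self G d v = cong (if_then d v ∸ deg G v else _) (dec-true (v ≟ v) refl)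

fire-other : ∀ {n} (G : Graph n) d {v w} → w ≢ v → fire G d v w ≡ d w + indicator (adj G v w)
fire-other G d {v} {w} w≢v =
  trans (cong (if_then d w ∸ deg G v else _) (dec-false (w ≟ v) w≢v)) (if-suc (adj G v w))
  where
  if-suc : ∀ b → (if b then suc (d w) else d w) ≡ d w + indicator b
  if-suc true  = sym (+-comm (d w) 1)
  if-suc false = sym (+-identityʳ (d w))

module _ {n : ℕ} (G : Graph n) where

  degIn : VertexSet n → Fin n → ℕ
  degIn U v = sumOver U (λ u → indicator (adj G v u))

  -- twice the number of edges of the subgraph induced by U
  inducedDegSum : VertexSet n → ℕ
  inducedDegSum U = sumOver U (degIn U)

  CoversEdges : Config n → Set
  CoversEdges c = ∀ U → inducedDegSum U ≤ 2 * sumOver U c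

  degIn-extends : ∀ {U v U'} → Extends U v U' → ∀ w → degIn U' w ≡ degIn U w + indicator (adj G w v)
  degIn-extends U⊕v w = sumOver-extends U⊕v _

  degIn-∁ : ∀ U v → degIn U v + degIn (∁ U) v ≡ deg G v
  degIn-∁ U v = sumOver-∁ U _

  sumOver-adj-sym : ∀ U v → sumOver U (λ u → indicator (adj G u v)) ≡ degIn U v
  sumOver-adj-sym U v = sumOver-cong U (λ u → cong indicator (adj-sym G u v))

  inducedDegSum-extends : ∀ {U v U'} → Extends U v U' → inducedDegSum U' ≡ inducedDegSum U + 2 * degIn U v
  inducedDegSum-extends {U} {v} {U'} U⊕v@(v∉U , v∈U' , U'≗U) = begin
    inducedDegSum U'
      ≡⟨ sumFin-update n v (degIn U v) outside-v at-v ⟩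
    sumOver U (λ u → degIn U u + indicator (adj G u v)) + degIn U v
      ≡⟨ cong (_+ degIn U v) (sumOver-+ U _ _) ⟩
    inducedDegSum U + sumOver U (λ u → indicator (adj G u v)) + degIn U v
      ≡⟨ cong (λ d → inducedDegSum U + d + degIn U v) (sumOver-adj-sym U v) ⟩
    inducedDegSum U + degIn U v + degIn U v
      ≡⟨ +-assoc (inducedDegSum U) _ _ ⟩
    inducedDegSum U + (degIn U v + degIn U v)
      ≡⟨ cong (λ d → inducedDegSum U + (degIn U v + d)) (sym (+-identityʳ _)) ⟩
    inducedDegSum U + 2 * degIn U v ∎
    where
    open ≡-Reasoning
    outside-v : ∀ u → u ≢ v → mask (U' u) (degIn U' u) ≡ mask (U u) (degIn U u + indicator (adj G u v))
    outside-v u u≢v = cong₂ mask (U'≗U u u≢v) (degIn-extends U⊕v u)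
    at-v : mask (U' v) (degIn U' v) ≡ mask (U v) (degIn U v + indicator (adj G v v)) + degIn U v
    at-v rewrite v∉U | v∈U' | degIn-extends U⊕v v | irrefl G v = +-identityʳ _

  inducedDegSum-full : ∀ U → (∀ u → U u ≡ true) → inducedDegSum U ≡ sumFin n (deg G)
  inducedDegSum-full U U-full =
    trans (sumOver-full U U-full _) (sumFin-cong n (λ u → sumOver-full U U-full _))

  crossing-edge : ∀ (U : VertexSet n) {a b} → Walk G a b → U a ≡ true → U b ≡ false →
    ∃₂ λ p q → U p ≡ true × U q ≡ false × adj G p q ≡ true
  crossing-edge U here a∈U a∉U = contradiction (trans (sym a∈U) a∉U) λ ()
  crossing-edge U (step {w = w} a~w walk) a∈U b∉U with U w in w∈U
  ... | true  = crossing-edge U walk w∈U b∉U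
  ... | false = _ , _ , a∈U , w∈U , a~w

  inducedDegSum-tree : IsTree G → ∀ U → ∃[ u ] U u ≡ true → inducedDegSum U + 2 ≤ 2 * card U
  inducedDegSum-tree (connected , handshake) U U≠∅ = by-outside (card (∁ U)) U refl U≠∅
    where
    by-outside : ∀ k U → card (∁ U) ≡ k → ∃[ u ] U u ≡ true → inducedDegSum U + 2 ≤ 2 * card U
    by-outside zero U ∁U≡0 (u , _) = ≤-reflexive (begin
      inducedDegSum U + 2        ≡⟨ cong (_+ 2) (trans (inducedDegSum-full U U-full) handshake) ⟩
      2 * (n ∸ 1) + 2            ≡⟨ *-distribˡ-+ 2 (n ∸ 1) 1 ⟨
      2 * (n ∸ 1 + 1)            ≡⟨ cong (2 *_) (m∸n+n≡m (>-nonZero⁻¹ n {{Fin.nonZeroIndex u}})) ⟩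
      2 * n                      ≡⟨ cong (2 *_) (card-full U U-full) ⟨
      2 * card U                 ∎)
      where
      open ≡-Reasoning
      U-full : ∀ u → U u ≡ true
      U-full = card-∁≡0⇒full U ∁U≡0
    by-outside (suc k) U ∁U≡1+k (u , u∈U) with card-∁>0⇒∃-outside U (subst (0 <_) (sym ∁U≡1+k) z<s)
    ... | w , w∉U with crossing-edge U (connected u w) u∈U w∉U
    ... | p , q , p∈U , q∉U , p~q = begin
      inducedDegSum U + 2              ≤⟨ +-monoʳ-≤ (inducedDegSum U) (*-monoʳ-≤ 2 1≤degIn) ⟩
      inducedDegSum U + 2 * degIn U q  ≤⟨ +-cancelʳ-≤ 2 _ _ grown ⟩
      2 * card U                       ∎
      where
      open ≤-Reasoning
      U+q : Extends U q (update U q true)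
      U+q = extends-insert U q q∉U
      1≤degIn : 1 ≤ degIn U q
      1≤degIn = subst (_≤ degIn U q)
        (cong₂ (λ b e → mask b (indicator e)) p∈U (trans (adj-sym G q p) p~q))
        (f≤sumFin n p _)
      ih : inducedDegSum (update U q true) + 2 ≤ 2 * card (update U q true)
      ih = by-outside k (update U q true)
             (suc-injective (trans (sym (card-extends (extends-∁ U+q))) ∁U≡1+k))
             (q , update-here U q true)
      grown : inducedDegSum U + 2 * degIn U q + 2 ≤ 2 * card U + 2
      grown = subst₂ _≤_ (cong (_+ 2) (inducedDegSum-extends U+q))
                (trans (cong (2 *_) (card-extends U+q)) (trans (*-suc 2 _) (+-comm 2 _)))
                ih

  open DecMembership (_≟_ {n}) using (_∈?_)

  neighbourFirings : Fin n → List (Fin n) → ℕ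
  neighbourFirings v vs = sum (map (λ u → indicator (adj G v u)) vs)

  fireSeq-unfired : ∀ d vs {v} → v ∉ vs → fireSeq G d vs v ≡ d v + neighbourFirings v vs
  fireSeq-unfired d []       {v} _    = sym (+-identityʳ (d v))
  fireSeq-unfired d (u ∷ us) {v} v∉vs = begin
    fireSeq G (fire G d u) us v                                 ≡⟨ fireSeq-unfired (fire G d u) us (v∉vs ∘ there) ⟩
    fire G d u v + neighbourFirings v us                        ≡⟨ cong (_+ neighbourFirings v us) (fire-other G d (v∉vs ∘ here)) ⟩
    d v + indicator (adj G u v) + neighbourFirings v us         ≡⟨ +-assoc (d v) _ _ ⟩
    d v + (indicator (adj G u v) + neighbourFirings v us)       ≡⟨ cong (λ b → d v + (indicator b + neighbourFirings v us)) (adj-sym G u v) ⟩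
    d v + neighbourFirings v (u ∷ us)                           ∎
    where open ≡-Reasoning

  neighbour-fired : ∀ {u v vs} → u ∈ vs → adj G v u ≡ true → 1 ≤ neighbourFirings v vs
  neighbour-fired {u} {v} (here refl) v~u = ≤-trans (≤-reflexive (cong indicator (sym v~u))) (m≤m+n _ _)
  neighbour-fired (there u∈vs) v~u = ≤-trans (neighbour-fired u∈vs v~u) (m≤n+m _ _)

  fireSeq-covers : ∀ vs d U → U ⊆ₗ vs → inducedDegSum U ≤ 2 * sumOver U (fireSeq G d vs)
  fireSeq-covers []       d U U⊆[] = ≤-trans (≤-reflexive (sumOver-empty U (⊆[]⇒empty U U⊆[]) _)) z≤n
  fireSeq-covers (v ∷ vs) d U U⊆ with U v in Uv | v ∈? vs
  ... | false | _        = fireSeq-covers vs (fire G d v) U (⊆-tail U⊆ λ v∈U → contradiction (trans (sym Uv) v∈U) λ ())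
  ... | true  | yes v∈vs = fireSeq-covers vs (fire G d v) U (⊆-tail U⊆ λ _ → v∈vs)
  ... | true  | no  v∉vs = begin
    inducedDegSum U                          ≡⟨ inducedDegSum-extends U−v⊕v ⟩
    inducedDegSum U−v + 2 * degIn U−v v      ≤⟨ +-mono-≤ (fireSeq-covers vs (fire G d v) U−v (remove-⊆ U⊆)) (*-monoʳ-≤ 2 last-firing) ⟩
    2 * sumOver U−v d′ + 2 * d′ v            ≡⟨ *-distribˡ-+ 2 (sumOver U−v d′) (d′ v) ⟨
    2 * (sumOver U−v d′ + d′ v)              ≡⟨ cong (2 *_) (sumOver-extends U−v⊕v d′) ⟨
    2 * sumOver U d′                         ∎
    where
    open ≤-Reasoning
    U−v : VertexSet n
    U−v = update U v false
    U−v⊕v : Extends U−v v U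
    U−v⊕v = extends-remove U v Uv
    d′ : Config n
    d′ = fireSeq G (fire G d v) vs
    -- after its last firing, v gains a chip whenever a neighbour fires
    last-firing : degIn U−v v ≤ d′ v
    last-firing = begin
      degIn U−v v                           ≤⟨ sumOver-⊆ U−v vs _ (remove-⊆ U⊆) ⟩
      neighbourFirings v vs                 ≤⟨ m≤n+m _ _ ⟩
      fire G d v v + neighbourFirings v vs  ≡⟨ fireSeq-unfired (fire G d v) vs v∉vs ⟨
      d′ v                                  ∎

  returning⇒fires-all : Connected G → ∀ d vs → vs ≢ [] → (∀ i → fireSeq G d vs i ≡ d i) → ∀ w → w ∈ vs
  returning⇒fires-all connected d []         []≢[] _       _ = contradiction refl []≢[]
  returning⇒fires-all connected d vs@(r ∷ _) _     returns w = spread (connected r w) (here refl)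
    where
    neighbour-fires : ∀ {u w} → u ∈ vs → adj G u w ≡ true → w ∈ vs
    neighbour-fires {u} {w} u∈vs u~w with w ∈? vs
    ... | yes w∈vs = w∈vs
    ... | no  w∉vs = contradiction gains-chip (<-irrefl refl)
      where
      open ≤-Reasoning
      gains-chip : d w < d w
      gains-chip = begin-strict
        d w                          <⟨ m<m+n (d w) z<s ⟩
        d w + 1                      ≤⟨ +-monoʳ-≤ (d w) (neighbour-fired u∈vs (trans (adj-sym G w u) u~w)) ⟩
        d w + neighbourFirings w vs  ≡⟨ fireSeq-unfired d vs w∉vs ⟨
        fireSeq G d vs w             ≡⟨ returns w ⟩
        d w                          ∎
    spread : ∀ {a b} → Walk G a b → a ∈ vs → b ∈ vs
    spread here            a∈vs = a∈vs
    spread (step a~x walk) a∈vs = spread walk (neighbour-fires a∈vs a~x)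

  selfReachable⇒coversEdges : Connected G → ∀ {c} → SelfReachable G c → CoversEdges c
  selfReachable⇒coversEdges connected {c} (vs , vs≢[] , _ , returns) U = begin
    inducedDegSum U                 ≤⟨ fireSeq-covers vs c U (λ u _ → returning⇒fires-all connected c vs vs≢[] returns u) ⟩
    2 * sumOver U (fireSeq G c vs)  ≡⟨ cong (2 *_) (sumOver-cong U returns) ⟩
    2 * sumOver U c                 ∎
    where open ≤-Reasoning

  module _ (tree : IsTree G) {c : Config n} (covers : CoversEdges c) where

    ready-vertex : ∀ U → ∃[ u ] U u ≡ true → ∃[ v ] U v ≡ true × degIn U v ≤ c v
    ready-vertex U U≠∅ =
      let v , v∈U , degIn<1+c = sumOver-<⇒∃< U (degIn U) (λ v → c v + 1) fewer-edges-than-chips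
      in v , v∈U , ≤-pred (subst (degIn U v <_) (+-comm (c v) 1) degIn<1+c)
      where
      e : ℕ
      e = inducedDegSum U
      fewer-edges-than-chips : e < sumOver U (λ v → c v + 1)
      fewer-edges-than-chips = *-cancelˡ-≤ 2 (begin
        2 * suc e        ≡⟨ twice-suc e ⟨
        e + (e + 2)      ≤⟨ +-mono-≤ (covers U) (inducedDegSum-tree tree U U≠∅) ⟩
        2 * sumOver U c + 2 * card U ≡⟨ *-distribˡ-+ 2 (sumOver U c) (card U) ⟨
        2 * (sumOver U c + card U)   ≡⟨ cong (2 *_) (sumOver-+ U c _) ⟨
        2 * sumOver U (λ v → c v + 1) ∎)
        where
        open ≤-Reasoning
        twice-suc : ∀ e → e + (e + 2) ≡ 2 * suc e
        twice-suc = solve-∀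

    -- d = c - Δ(G) 1_F, written without subtraction
    FiredOnce : VertexSet n → Config n → Set
    FiredOnce F d = ∀ w → d w + mask (F w) (deg G w) ≡ c w + degIn F w

    fire-ready : ∀ F d v → FiredOnce F d → F v ≡ false → degIn (∁ F) v ≤ c v →
      deg G v ≤ d v × FiredOnce (update F v true) (fire G d v)
    fire-ready F d v fired v∉F ready = legal , ∀-split-at v fired-v fired-off-v
      where
      F+v : Extends F v (update F v true)
      F+v = extends-insert F v v∉F
      d-at-v : d v ≡ c v + degIn F v
      d-at-v = trans (sym (+-identityʳ (d v))) (subst (λ b → d v + mask b (deg G v) ≡ c v + degIn F v) v∉F (fired v))
      legal : deg G v ≤ d v
      legal = begin
        deg G v                   ≡⟨ degIn-∁ F v ⟨
        degIn F v + degIn (∁ F) v ≤⟨ +-monoʳ-≤ (degIn F v) ready ⟩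
        degIn F v + c v           ≡⟨ trans (+-comm (degIn F v) (c v)) (sym d-at-v) ⟩
        d v                       ∎
        where open ≤-Reasoning
      fired-v : fire G d v v + mask (update F v true v) (deg G v) ≡ c v + degIn (update F v true) v
      fired-v = begin
        fire G d v v + mask (update F v true v) (deg G v)
          ≡⟨ cong₂ (λ x b → x + mask b (deg G v)) (fire-self G d v) (update-here F v true) ⟩
        d v ∸ deg G v + deg G v                    ≡⟨ m∸n+n≡m legal ⟩
        d v                                        ≡⟨ d-at-v ⟩
        c v + degIn F v                            ≡⟨ cong (c v +_) (sym (+-identityʳ _)) ⟩
        c v + (degIn F v + 0)                      ≡⟨ cong (λ b → c v + (degIn F v + indicator b)) (irrefl G v) ⟨
        c v + (degIn F v + indicator (adj G v v))  ≡⟨ cong (c v +_) (degIn-extends F+v v) ⟨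
        c v + degIn (update F v true) v            ∎
        where open ≡-Reasoning
      fired-off-v : ∀ w → w ≢ v → fire G d v w + mask (update F v true w) (deg G w) ≡ c w + degIn (update F v true) w
      fired-off-v w w≢v = begin
        fire G d v w + mask (update F v true w) (deg G w)
          ≡⟨ cong₂ (λ x b → x + mask b (deg G w)) (fire-other G d w≢v) (update-other F v true w≢v) ⟩
        d w + indicator (adj G v w) + mask (F w) (deg G w)  ≡⟨ xy∙z≈xz∙y (d w) _ _ ⟩
        d w + mask (F w) (deg G w) + indicator (adj G v w)  ≡⟨ cong₂ _+_ (fired w) (cong indicator (adj-sym G v w)) ⟩
        c w + degIn F w + indicator (adj G w v)             ≡⟨ +-assoc (c w) _ _ ⟩
        c w + (degIn F w + indicator (adj G w v))           ≡⟨ cong (c w +_) (degIn-extends F+v w) ⟨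
        c w + degIn (update F v true) w                     ∎
        where open ≡-Reasoning

    fire-unfired : ∀ k F d → card (∁ F) ≡ k → FiredOnce F d →
      ∃[ vs ] length vs ≡ k × LegalSeq G d vs × (∀ w → fireSeq G d vs w ≡ c w)
    fire-unfired zero F d ∁F≡0 fired = [] , refl , tt , returned
      where
      F-full : ∀ u → F u ≡ true
      F-full = card-∁≡0⇒full F ∁F≡0
      returned : ∀ w → d w ≡ c w
      returned w = +-cancelʳ-≡ (deg G w) (d w) (c w) (begin
        d w + deg G w                ≡⟨ cong (λ b → d w + mask b (deg G w)) (F-full w) ⟨
        d w + mask (F w) (deg G w)   ≡⟨ fired w ⟩
        c w + degIn F w              ≡⟨ cong (c w +_) (sumOver-full F F-full _) ⟩
        c w + deg G w                ∎)
        where open ≡-Reasoning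
    fire-unfired (suc k) F d ∁F≡1+k fired
      with card-∁>0⇒∃-outside F (subst (0 <_) (sym ∁F≡1+k) z<s)
    ... | u , u∉F with ready-vertex (∁ F) (u , cong not u∉F)
    ... | v , v∈∁F , ready =
      let v∉F : F v ≡ false
          v∉F = not-injective v∈∁F
          legal , fired′ = fire-ready F d v fired v∉F ready
          ∁F′≡k : card (∁ (update F v true)) ≡ k
          ∁F′≡k = suc-injective (trans (sym (card-extends (extends-∁ (extends-insert F v v∉F)))) ∁F≡1+k)
          vs , length≡k , legal-vs , returns = fire-unfired k (update F v true) (fire G d v) ∁F′≡k fired′
      in v ∷ vs , cong suc length≡k , (legal , legal-vs) , returns

    coversEdges⇒selfReachable : 1 ≤ n → SelfReachable G c
    coversEdges⇒selfReachable 1≤n =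
      let vs , length≡n , legal , returns = fire-unfired n (λ _ → false) c (card-full _ λ _ → refl) nothing-fired
      in vs , (λ vs≡[] → >⇒≢ 1≤n (trans (sym length≡n) (cong length vs≡[]))) , legal , returns
      where
      nothing-fired : FiredOnce (λ _ → false) c
      nothing-fired w = cong (c w +_) (sym (sumFin-zero n λ _ → refl))

ℤtoℚ≡mkℚ : ∀ z → ℤtoℚ z ≡ mkℚ z 0 (Coprimality.sym (Coprimality.1-coprimeTo _))
ℤtoℚ≡mkℚ z = ℚ.↥p/↧p≡p (mkℚ z 0 _)

ℤtoℚ-+ : ∀ a b → ℤtoℚ (a ℤ.+ b) ≡ ℤtoℚ a ℚ.+ ℤtoℚ b
ℤtoℚ-+ a b rewrite ℤtoℚ≡mkℚ a | ℤtoℚ≡mkℚ b =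
  cong ℤtoℚ (sym (cong₂ ℤ._+_ (ℤ.*-identityʳ a) (ℤ.*-identityʳ b)))

ℤtoℚ-* : ∀ a b → ℤtoℚ (a ℤ.* b) ≡ ℤtoℚ a ℚ.* ℤtoℚ b
ℤtoℚ-* a b rewrite ℤtoℚ≡mkℚ a | ℤtoℚ≡mkℚ b = refl

ℤtoℚ-mono-≤ : ∀ {a b} → a ℤ.≤ b → ℤtoℚ a ℚ.≤ ℤtoℚ b
ℤtoℚ-mono-≤ {a} {b} a≤b rewrite ℤtoℚ≡mkℚ a | ℤtoℚ≡mkℚ b =
  *≤* (subst₂ ℤ._≤_ (sym (ℤ.*-identityʳ a)) (sym (ℤ.*-identityʳ b)) a≤b)

ℤtoℚ-cancel-≤ : ∀ {a b} → ℤtoℚ a ℚ.≤ ℤtoℚ b → a ℤ.≤ b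
ℤtoℚ-cancel-≤ {a} {b} a≤b rewrite ℤtoℚ≡mkℚ a | ℤtoℚ≡mkℚ b with a≤b
... | *≤* a≤b = subst₂ ℤ._≤_ (ℤ.*-identityʳ a) (ℤ.*-identityʳ b) a≤b

ℕtoℚ-+ : ∀ a b → ℕtoℚ (a + b) ≡ ℕtoℚ a ℚ.+ ℕtoℚ b
ℕtoℚ-+ a b = ℤtoℚ-+ (ℤ.+ a) (ℤ.+ b)

ℕtoℚ-* : ∀ a b → ℕtoℚ (a * b) ≡ ℕtoℚ a ℚ.* ℕtoℚ b
ℕtoℚ-* a b = trans (cong ℤtoℚ (ℤ.pos-* a b)) (ℤtoℚ-* (ℤ.+ a) (ℤ.+ b))

ℕtoℚ-mono-≤ : ∀ {a b} → a ≤ b → ℕtoℚ a ℚ.≤ ℕtoℚ b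
ℕtoℚ-mono-≤ a≤b = ℤtoℚ-mono-≤ (ℤ.+≤+ a≤b)

ℕtoℚ-cancel-≤ : ∀ {a b} → ℕtoℚ a ℚ.≤ ℕtoℚ b → a ≤ b
ℕtoℚ-cancel-≤ a≤b = ℤ.drop‿+≤+ (ℤtoℚ-cancel-≤ a≤b)

ℕtoℚ-sumFin : ∀ n (f : Fin n → ℕ) → ℕtoℚ (sumFin n f) ≡ ∑ (ℕtoℚ ∘ f)
ℕtoℚ-sumFin zero    f = refl
ℕtoℚ-sumFin (suc n) f = trans (ℕtoℚ-+ (f zero) _) (cong (ℕtoℚ (f zero) ℚ.+_) (ℕtoℚ-sumFin n (f ∘ suc)))

combAt-nonneg : ∀ {n} {P : Config n → Set} (ps : List (ℚ × Config n)) →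
  All (λ p → 0ℚ ℚ.≤ proj₁ p × P (proj₂ p)) ps → ∀ i → 0ℚ ℚ.≤ combAt ps i
combAt-nonneg []             []                i = ℚ.≤-refl
combAt-nonneg ((w , s) ∷ ps) ((0≤w , _) ∷ 0≤ps) i = begin
  0ℚ                          ≡⟨ trans (ℚ.+-identityʳ _) (ℚ.*-zeroʳ w) ⟨
  w ℚ.* 0ℚ ℚ.+ 0ℚ             ≤⟨ ℚ.+-mono-≤ (ℚ.*-monoˡ-≤-nonNeg w {{ℚ.nonNegative 0≤w}} (ℕtoℚ-mono-≤ {b = s i} z≤n))
                                            (combAt-nonneg ps 0≤ps i) ⟩
  w ℚ.* ℕtoℚ (s i) ℚ.+ combAt ps i ∎
  where open ℚ.≤-Reasoning

module _ {n : ℕ} (a : Fin n → ℕ) where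

  weightedSum : Config n → ℕ
  weightedSum s = sumFin n (λ i → a i * s i)

  weightedSumℚ : (Fin n → ℚ) → ℚ
  weightedSumℚ y = ∑ (λ i → ℕtoℚ (a i) ℚ.* y i)

  ℕtoℚ-weightedSum : ∀ s → ℕtoℚ (weightedSum s) ≡ weightedSumℚ (ℕtoℚ ∘ s)
  ℕtoℚ-weightedSum s = trans (ℕtoℚ-sumFin n _) (sum-cong-≗ (λ i → ℕtoℚ-* (a i) (s i)))

  weightedSumℚ-combAt : ∀ w s ps →
    weightedSumℚ (combAt ((w , s) ∷ ps)) ≡ w ℚ.* ℕtoℚ (weightedSum s) ℚ.+ weightedSumℚ (combAt ps)
  weightedSumℚ-combAt w s ps = begin
    ∑ (λ i → ℕtoℚ (a i) ℚ.* (w ℚ.* ℕtoℚ (s i) ℚ.+ combAt ps i))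
      ≡⟨ sum-cong-≗ (λ i → distrib (ℕtoℚ (a i)) w (ℕtoℚ (s i)) (combAt ps i)) ⟩
    ∑ (λ i → w ℚ.* (ℕtoℚ (a i) ℚ.* ℕtoℚ (s i)) ℚ.+ ℕtoℚ (a i) ℚ.* combAt ps i)
      ≡⟨ ∑-distrib-+ (λ i → w ℚ.* (ℕtoℚ (a i) ℚ.* ℕtoℚ (s i))) (λ i → ℕtoℚ (a i) ℚ.* combAt ps i) ⟩
    ∑ (λ i → w ℚ.* (ℕtoℚ (a i) ℚ.* ℕtoℚ (s i))) ℚ.+ weightedSumℚ (combAt ps)
      ≡⟨ cong (ℚ._+ weightedSumℚ (combAt ps)) (*-distribˡ-sum w (λ i → ℕtoℚ (a i) ℚ.* ℕtoℚ (s i))) ⟨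
    w ℚ.* weightedSumℚ (ℕtoℚ ∘ s) ℚ.+ weightedSumℚ (combAt ps)
      ≡⟨ cong (λ x → w ℚ.* x ℚ.+ weightedSumℚ (combAt ps)) (ℕtoℚ-weightedSum s) ⟨
    w ℚ.* ℕtoℚ (weightedSum s) ℚ.+ weightedSumℚ (combAt ps) ∎
    where
    open ≡-Reasoning
    open +-*-Solver
    distrib : ∀ x w y z → x ℚ.* (w ℚ.* y ℚ.+ z) ≡ w ℚ.* (x ℚ.* y) ℚ.+ x ℚ.* z
    distrib = solve 4 (λ x w y z → x :* (w :* y :+ z) := w :* (x :* y) :+ x :* z) refl

  weightedSumℚ-combAt-≥ : ∀ K ps → All (λ p → 0ℚ ℚ.≤ proj₁ p × K ≤ weightedSum (proj₂ p)) ps →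
    ℕtoℚ K ℚ.* sumWeights ps ℚ.≤ weightedSumℚ (combAt ps)
  weightedSumℚ-combAt-≥ K [] [] = ℚ.≤-reflexive (begin
    ℕtoℚ K ℚ.* 0ℚ                     ≡⟨ ℚ.*-zeroʳ (ℕtoℚ K) ⟩
    0ℚ                                ≡⟨ sum-replicate-zero n ⟨
    ∑ {n} (λ _ → 0ℚ)                  ≡⟨ sum-cong-≗ (λ i → ℚ.*-zeroʳ (ℕtoℚ (a i))) ⟨
    weightedSumℚ (combAt {n} [])      ∎)
    where open ≡-Reasoning
  weightedSumℚ-combAt-≥ K ((w , s) ∷ ps) ((0≤w , K≤s) ∷ K≤ps) = begin
    ℕtoℚ K ℚ.* (w ℚ.+ sumWeights ps)                        ≡⟨ ℚ.*-distribˡ-+ (ℕtoℚ K) w _ ⟩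
    ℕtoℚ K ℚ.* w ℚ.+ ℕtoℚ K ℚ.* sumWeights ps               ≡⟨ cong (ℚ._+ _) (ℚ.*-comm (ℕtoℚ K) w) ⟩
    w ℚ.* ℕtoℚ K ℚ.+ ℕtoℚ K ℚ.* sumWeights ps               ≤⟨ ℚ.+-mono-≤ (ℚ.*-monoˡ-≤-nonNeg w {{ℚ.nonNegative 0≤w}} (ℕtoℚ-mono-≤ {b = weightedSum s} K≤s))
                                                                            (weightedSumℚ-combAt-≥ K ps K≤ps) ⟩
    w ℚ.* ℕtoℚ (weightedSum s) ℚ.+ weightedSumℚ (combAt ps) ≡⟨ weightedSumℚ-combAt w s ps ⟨
    weightedSumℚ (combAt ((w , s) ∷ ps))                     ∎
    where open ℚ.≤-Reasoning

  halfspace-convex : ∀ K ps → All (λ p → 0ℚ ℚ.≤ proj₁ p × K ≤ weightedSum (proj₂ p)) ps →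
    sumWeights ps ≡ 1ℚ → ∀ c → (∀ i → combAt ps i ≡ ℕtoℚ (c i)) → K ≤ weightedSum c
  halfspace-convex K ps K≤ps Σw≡1 c ps→c = ℕtoℚ-cancel-≤ (begin
    ℕtoℚ K                         ≡⟨ ℚ.*-identityʳ _ ⟨
    ℕtoℚ K ℚ.* 1ℚ                  ≡⟨ cong (ℕtoℚ K ℚ.*_) Σw≡1 ⟨
    ℕtoℚ K ℚ.* sumWeights ps       ≤⟨ weightedSumℚ-combAt-≥ K ps K≤ps ⟩
    weightedSumℚ (combAt ps)       ≡⟨ sum-cong-≗ (λ i → cong (ℕtoℚ (a i) ℚ.*_) (ps→c i)) ⟩
    weightedSumℚ (ℕtoℚ ∘ c)        ≡⟨ ℕtoℚ-weightedSum c ⟨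
    ℕtoℚ (weightedSum c)           ∎)
    where open ℚ.≤-Reasoning

weightedSum-mask : ∀ {n} (U : VertexSet n) k s → weightedSum (λ i → mask (U i) k) s ≡ k * sumOver U s
weightedSum-mask {n} U k s = trans (sumFin-cong n (λ i → mask-*-comm (U i) k (s i))) (sumFin-*ˡ n k _)

coversEdges-convex : ∀ {n} (G : Graph n) ps → All (λ p → 0ℚ ℚ.≤ proj₁ p × CoversEdges G (proj₂ p)) ps →
  sumWeights ps ≡ 1ℚ → ∀ c → (∀ i → combAt ps i ≡ ℕtoℚ (c i)) → CoversEdges G c
coversEdges-convex {n} G ps covers Σw≡1 c ps→c U =
  subst (inducedDegSum G U ≤_) (weightedSum-mask U 2 c)
    (halfspace-convex 2U (inducedDegSum G U) ps (All.map in-halfspace covers) Σw≡1 c ps→c)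
  where
  2U : Fin n → ℕ
  2U i = mask (U i) 2
  in-halfspace : ∀ {p} → 0ℚ ℚ.≤ proj₁ p × CoversEdges G (proj₂ p) → 0ℚ ℚ.≤ proj₁ p × inducedDegSum G U ≤ weightedSum 2U (proj₂ p)
  in-halfspace (0≤w , covers-s) = 0≤w , subst (inducedDegSum G U ≤_) (sym (weightedSum-mask U 2 _)) (covers-s U)

open import Data.Integer using (+_)

corollary4p3 : (n : ℕ) → 1 ≤ n → (T : Graph n) → IsTree T → (ℓ : ℕ) → 1 ≤ ℓ →
    (x : Fin n → ℤ) → InP T ℓ (λ i → ℤtoℚ (x i)) →
    Σ (Config n) (λ c → ((i : Fin n) → + (c i) ≡ x i) × SelfReachable T c)
corollary4p3 n 1≤n T tree ℓ _ x (ps , points , Σw≡1 , x≡comb) =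
  c , +c≡x , coversEdges⇒selfReachable T tree c-covers 1≤n
  where
  c : Config n
  c i = ℤ.∣ x i ∣
  +c≡x : ∀ i → + c i ≡ x i
  +c≡x i = ℤ.0≤i⇒+∣i∣≡i (ℤtoℚ-cancel-≤ (subst (0ℚ ℚ.≤_) (sym (x≡comb i)) (combAt-nonneg ps points i)))
  c-covers : CoversEdges T c
  c-covers = coversEdges-convex T ps
    (All.map (λ (0≤w , reachable , _) → 0≤w , selfReachable⇒coversEdges T (proj₁ tree) reachable) points)
    Σw≡1 c (λ i → trans (sym (x≡comb i)) (cong ℤtoℚ (sym (+c≡x i))))
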